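{- Let $X$ be a type, $f:X\to X$ and $I:\prod_{x:X}(f(f(x))=f(x))$. Suppose $f$ is weakly constant, i.e. we have $\prod_{x,y:X}(f(x)=f(y))$. Then $f$ has a splitting. That is, there exist a type $A$, maps $r:X\to A$ and $s:A\to X$, and homotopies $H:\prod_{a:A}(r(s(a))=a)$ and $K:\prod_{x:X}(s(r(x))=f(x))$.
   Context: Intensional Martin-Löf type theory; no extensionality axioms are assumed. -}

module Defs where

open import Level using (Level)
open import Relation.Binary.PropositionalEquality using (_≡_)

WeaklyConstant : ∀ {ℓ} {X : Set ℓ} → (X → X) → Set ℓ
WeaklyConstant {X = X} f = (x y : X) → f x ≡ f y

module Submission where

-- The splitting type is the type of fixed points  Fix f = Σ x , f x ≡ x,
-- with  s = proj₁  and  r x = (f x , idem x), where  idem x : f (f x) ≡ f x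
-- is the CANONICAL idempotence witness built from weak constancy
--   idem x = (w (f x) (f x))⁻¹ · w (f x) x.  Then  s (r x) = f x
-- holds definitionally, and  r (s (x , p)) ≡ (x , p)  reduces, via transport
-- in the fibration  z ↦ f z ≡ z, to the path identity
--   (cong f p)⁻¹ · idem x · p ≡ p,
-- which follows from the key fact about weakly constant maps: for any base
-- point u, cong f p ≡ (w u y)⁻¹ · w u z  for  p : y ≡ z  (here u = y = f x).

open import Defs
open import Level using (Level)
open import Data.Product using (Σ; _×_; _,_; proj₁)
open import Data.Product.Properties using (Σ-≡,≡→≡)
open import Relation.Binary.PropositionalEquality
  using (_≡_; refl; sym; trans; cong; subst; module ≡-Reasoning)
open import Relation.Binary.PropositionalEquality.Properties
  using (trans-reflʳ; trans-symˡ; trans-assoc)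

trans-sym-cancelˡ : ∀ {a} {A : Set a} {x y z : A} (q : x ≡ y) (r : y ≡ z) →
                    trans (sym q) (trans q r) ≡ r
trans-sym-cancelˡ q r = begin
  trans (sym q) (trans q r)  ≡⟨ sym (trans-assoc (sym q)) ⟩
  trans (trans (sym q) q) r  ≡⟨ cong (λ t → trans t r) (trans-symˡ q) ⟩
  r                          ∎
  where open ≡-Reasoning

subst-fixed-point : ∀ {ℓ} {X : Set ℓ} (f : X → X) {x y : X} (p : x ≡ y) (q : f x ≡ x) →
                    subst (λ z → f z ≡ z) p q ≡ trans (sym (cong f p)) (trans q p)
subst-fixed-point f refl q = sym (trans-reflʳ q)

cong-weakly-constant : ∀ {a b} {X : Set a} {Y : Set b} (f : X → Y)
                       (w : (x y : X) → f x ≡ f y) (u : X) {y z : X} (p : y ≡ z) →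
                       cong f p ≡ trans (sym (w u y)) (w u z)
cong-weakly-constant f w u {y} refl = sym (trans-symˡ (w u y))

module _ {ℓ : Level} {X : Set ℓ} (f : X → X) (w : WeaklyConstant f) where

  Fix : Set ℓ
  Fix = Σ X (λ x → f x ≡ x)

  idem : (x : X) → f (f x) ≡ f x
  idem x = trans (sym (w (f x) (f x))) (w (f x) x)

  toFix : X → Fix
  toFix x = f x , idem x

  toFix-proj₁ : (a : Fix) → toFix (proj₁ a) ≡ a
  toFix-proj₁ (x , p) = Σ-≡,≡→≡ (p , transported)
    where
      open ≡-Reasoning
      transported : subst (λ z → f z ≡ z) p (idem x) ≡ p
      transported = begin
        subst (λ z → f z ≡ z) p (idem x)
          ≡⟨ subst-fixed-point f p (idem x) ⟩
        trans (sym (cong f p)) (trans (idem x) p)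
          ≡⟨ cong (λ t → trans (sym (cong f p)) (trans t p))
                  (sym (cong-weakly-constant f w (f x) p)) ⟩
        trans (sym (cong f p)) (trans (cong f p) p)
          ≡⟨ trans-sym-cancelˡ (cong f p) p ⟩
        p ∎

theorem3p9 : ∀ {ℓ : Level} (X : Set ℓ) (f : X → X) (I : (x : X) → f (f x) ≡ f x) → WeaklyConstant f → Σ (Set ℓ) (λ A → Σ (X → A) (λ r → Σ (A → X) (λ s → ((a : A) → r (s a) ≡ a) × ((x : X) → s (r x) ≡ f x))))
theorem3p9 X f _ w = Fix f w , toFix f w , proj₁ , toFix-proj₁ f w , λ x → refl
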